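{- Let $n,k\ge1$ be integers and $p$ a prime such that $N_k(p)\cdot S_k(p)<p-1$. Let $\{e_1,\dots,e_n\}$ and $\{f_1,\dots,f_n\}$ be two bases of $\mathbb{F}_p^n$. Then there exist subsets $A_i,B_i\subseteq\mathbb{F}_p^*$ ($i\in[n]$) such that each $A_i$ is $S_k$-type, each $B_i$ is $N_k$-type, and whenever $x_i\in A_i$, $y_i\in B_i$ ($1\le i\le n$), we have $$\sum_{1\le i\le n}x_ie_i\neq\sum_{1\le i\le n}y_if_i.$$
   Context: $\mathbb{F}_p^*=\mathbb{F}_p\setminus\{0\}$. For an integer $k\ge1$ and a prime $p\ge2k+1$: $A\subseteq\mathbb{F}_p$ is $S_k$-type if for every $a\in A$ there is $d\in\mathbb{F}_p^*$ with $a+id\in A$ for all $-k\le i\le k$; $A$ is $N_k$-type if it is $S_k$-type and for every $a\notin A$ there is $d\in\mathbb{F}_p^*$ with $a+id\in A$ for all $1\le i\le k$. $S_k(p)$ and $N_k(p)$ are the minimum sizes of $S_k$-type, respectively $N_k$-type, subsets of $\mathbb{F}_p$. -}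

module Defs where

open import Data.Nat using (ℕ; zero; suc; _+_; _*_; _∸_; _≤_; NonZero)
open import Data.Nat.DivMod using (_mod_)
open import Data.Fin using (Fin; toℕ) renaming (zero to fz; suc to fs)
open import Data.Fin.Subset using (Subset; _∈_; _∉_; ∣_∣)
open import Data.Product using (Σ; ∃; _×_)
open import Relation.Binary.PropositionalEquality using (_≡_)
open import Relation.Nullary using (¬_)

module _ (p : ℕ) .{{_ : NonZero p}} where

  𝟘 : Fin p
  𝟘 = 0 mod p

  _+ₚ_ : Fin p → Fin p → Fin p
  a +ₚ b = (toℕ a + toℕ b) mod p

  _*ₚ_ : Fin p → Fin p → Fin p
  a *ₚ b = (toℕ a * toℕ b) mod p

  -ₚ_ : Fin p → Fin p
  -ₚ a = (p ∸ toℕ a) mod p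

  _·ₚ_ : ℕ → Fin p → Fin p
  i ·ₚ d = (i * toℕ d) mod p

  -- S_k-type: nonempty, and every a ∈ A is the centre of a
  -- (2k+1)-term AP a + i d (-k ≤ i ≤ k, d ≠ 0) contained in A.
  -- The index i ∈ [-k,k] is written as ±i with 0 ≤ i ≤ k.
  SType : ℕ → Subset p → Set
  SType k A =
    (∃ λ a → a ∈ A) ×
    (∀ a → a ∈ A → Σ (Fin p) λ d → ¬ (d ≡ 𝟘) ×
       (∀ i → i ≤ k → ((a +ₚ (i ·ₚ d)) ∈ A) × ((a +ₚ (i ·ₚ (-ₚ d))) ∈ A)))

  NType : ℕ → Subset p → Set
  NType k A =
    SType k A ×
    (∀ a → a ∉ A → Σ (Fin p) λ d → ¬ (d ≡ 𝟘) ×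
       (∀ i → 1 ≤ i → i ≤ k → (a +ₚ (i ·ₚ d)) ∈ A))

  IsMinSize : (Subset p → Set) → ℕ → Set
  IsMinSize P m = (∃ λ A → P A × ∣ A ∣ ≡ m) × (∀ A → P A → m ≤ ∣ A ∣)

  Vecₚ : ℕ → Set
  Vecₚ n = Fin n → Fin p

  sumₚ : ∀ n → (Fin n → Fin p) → Fin p
  sumₚ zero f = 𝟘
  sumₚ (suc n) f = f fz +ₚ sumₚ n (λ i → f (fs i))

  lincomb : ∀ {n} → (Fin n → Fin p) → (Fin n → Vecₚ n) → Vecₚ n
  lincomb {n} c e j = sumₚ n (λ i → c i *ₚ e i j)

  IsBasis : ∀ {n} → (Fin n → Vecₚ n) → Set
  IsBasis {n} e =
    (∀ (c : Fin n → Fin p) → (∀ j → lincomb c e j ≡ 𝟘) → ∀ i → c i ≡ 𝟘) ×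
    (∀ (v : Vecₚ n) → Σ (Fin n → Fin p) λ c → ∀ j → lincomb c e j ≡ v j)

-- Take S₀ of S_k-type and N₀ of N_k-type with s = |S₀| = S_k(p) and t = |N₀| = N_k(p), and
-- points c₀ ∉ S₀, c₁ ∉ N₀. For scalars μᵢ ≠ 0 put Aᵢ = {x : μᵢ x + c₀ ∈ S₀} and B = {y : y + c₁ ∈ N₀}; affine
-- maps preserve both types, and 0 lies in neither set. A solution of Σ xᵢ eᵢ = Σ yᵢ fᵢ is fixed
-- by y ∈ Bⁿ (tⁿ choices), which fixes x, and then by the points μᵢ xᵢ + c₀ ∈ S₀ (sⁿ choices),
-- which fix μ. So at most (ts)ⁿ < (p - 1)ⁿ scalar vectors μ admit a solution, and some μ admits
-- none.
module Submission where

open import Defs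
open import Data.Bool using (true; false)
open import Data.Fin using (Fin; toℕ; _≟_; combine; remQuot; finToFun; funToFin)
  renaming (zero to fz; suc to fs)
open import Data.Fin.Properties
  using (toℕ<n; toℕ-fromℕ<; toℕ-injective; suc-injective; injective⇒≤; all?; any?; ¬∀⟶∃¬;
         remQuot-combine; funToFin-finToFin; finToFun-funToFin)
open import Data.Fin.Subset using (Subset; _∈_; _∉_; ∣_∣; ⊤)
open import Data.Fin.Subset.Properties using (_∈?_; x∈p⇒∣p-x∣<∣p∣; p⊆q⇒∣p∣≤∣q∣; ∣⊤∣≡n)
open import Data.Nat using (ℕ; zero; suc; _+_; _*_; _∸_; _%_; _^_; _≤_; _<_; NonZero; z≤n; s≤s;
  >-nonZero; ≢-nonZero; ≢-nonZero⁻¹)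
open import Data.Nat.Coprimality using (prime⇒coprime; coprime-Bézout)
open import Data.Nat.DivMod
  using (_mod_; m%n<n; [m+n]%n≡m%n; [m+kn]%n≡m%n; %-distribˡ-+; %-distribˡ-*; m%n%n≡m%n; m<n⇒m%n≡m)
open import Data.Nat.GCD using (module Bézout)
open import Data.Nat.Primality using (Prime)
open import Data.Nat.Properties
  using (+-comm; *-assoc; *-zeroʳ; *-identityˡ; *-identityʳ; m∸n+n≡m; <⇒≤; <⇒≱; ≤-trans; ≤-<-trans;
         m<n⇒m<1+n; m≤m*n; m≤n*m; ^-monoˡ-<)
open import Data.Nat.Tactic.RingSolver using (solve-∀)
open import Data.Product using (Σ; ∃; _×_; _,_; proj₁; proj₂)
open import Data.Vec using (_∷_; []; here; there; tabulate; lookup)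
open import Data.Vec.Properties using (lookup∘tabulate; []=⇒lookup; lookup⇒[]=)
open import Function using (_∘_)
open import Relation.Binary.PropositionalEquality
open import Relation.Nullary using (¬_; Dec; yes; no; ¬?; contradiction)

x∈p⇒0<∣p∣ : ∀ {m} {A : Subset m} {x} → x ∈ A → 0 < ∣ A ∣
x∈p⇒0<∣p∣ x∈A = ≤-trans (s≤s z≤n) (x∈p⇒∣p-x∣<∣p∣ x∈A)

∣p∣<n⇒∃∉ : ∀ {m} (A : Subset m) → ∣ A ∣ < m → ∃ λ x → x ∉ A
∣p∣<n⇒∃∉ {m} A ∣A∣<m with all? (_∈? A)
... | yes all∈ = contradiction (subst (_≤ ∣ A ∣) (∣⊤∣≡n m) (p⊆q⇒∣p∣≤∣q∣ {p = ⊤} λ {x} _ → all∈ x)) (<⇒≱ ∣A∣<m)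
... | no ¬all∈ = ¬∀⟶∃¬ m (_∈ A) (_∈? A) ¬all∈

Enumeration : ∀ {m} → Subset m → Set
Enumeration {m} A = Σ (Fin ∣ A ∣ → Fin m) λ en → (∀ j → en j ∈ A) × (∀ {x} → x ∈ A → ∃ λ j → en j ≡ x)

enumerate : ∀ {m} (A : Subset m) → Enumeration A
enumerate [] = (λ ()) , (λ ()) , λ ()
enumerate {suc m} (true ∷ A) with enumerate A
... | en , en∈ , covers = en′ , en′∈ , covers′
  where
  en′ : Fin (suc ∣ A ∣) → Fin (suc m)
  en′ fz     = fz
  en′ (fs j) = fs (en j)
  en′∈ : ∀ j → en′ j ∈ true ∷ A
  en′∈ fz     = here
  en′∈ (fs j) = there (en∈ j)
  covers′ : ∀ {x} → x ∈ true ∷ A → ∃ λ j → en′ j ≡ x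
  covers′ here         = fz , refl
  covers′ (there x∈A) = let j , enj≡x = covers x∈A in fs j , cong fs enj≡x
enumerate (false ∷ A) with enumerate A
... | en , en∈ , covers = fs ∘ en , there ∘ en∈ , covers′
  where
  covers′ : ∀ {x} → x ∈ false ∷ A → ∃ λ j → fs (en j) ≡ x
  covers′ (there x∈A) = let j , enj≡x = covers x∈A in j , cong fs enj≡x

preimage : ∀ {m} → (Fin m → Fin m) → Subset m → Subset m
preimage g A = tabulate (λ x → lookup A (g x))

∈-preimage : ∀ {m} {g : Fin m → Fin m} {A x} → g x ∈ A → x ∈ preimage g A
∈-preimage {g = g} {A} {x} gx∈A =
  lookup⇒[]= x _ (trans (lookup∘tabulate (λ x → lookup A (g x)) x) ([]=⇒lookup gx∈A))

∈-preimage⁻ : ∀ {m} {g : Fin m → Fin m} {A x} → x ∈ preimage g A → g x ∈ A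
∈-preimage⁻ {g = g} {A} {x} x∈pre =
  lookup⇒[]= (g x) A (trans (sym (lookup∘tabulate (λ x → lookup A (g x)) x)) ([]=⇒lookup x∈pre))

funToFin-cong : ∀ {m k} {f g : Fin m → Fin k} → (∀ i → f i ≡ g i) → funToFin f ≡ funToFin g
funToFin-cong {zero}  f≗g = refl
funToFin-cong {suc m} f≗g = cong₂ combine (f≗g fz) (funToFin-cong {m} (f≗g ∘ fs))

finToFun-injective : ∀ {m k} {c c′ : Fin (k ^ m)} → (∀ i → finToFun c i ≡ finToFun c′ i) → c ≡ c′
finToFun-injective {m} {k} {c} {c′} c≗c′ =
  trans (sym (funToFin-finToFin {m} {k} c))
        (trans (funToFin-cong {m} {k} c≗c′) (funToFin-finToFin {m} {k} c′))

∃-unrelated : ∀ {m N} (R : Fin N → Fin m → Set) → (∀ c j → Dec (R c j)) →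
          (∀ {c c′ j} → R c j → R c′ j → c ≡ c′) → m < N → ∃ λ c → ∀ j → ¬ R c j
∃-unrelated R R? functional m<N with any? (λ c → all? (λ j → ¬? (R? c j)))
... | yes unhit  = unhit
... | no  ¬unhit = contradiction (injective⇒≤ hit-injective) (<⇒≱ m<N)
  where
  hit : ∀ c → ∃ (R c)
  hit c with any? (R? c)
  ... | yes h  = h
  ... | no  ¬h = contradiction (c , λ j r → ¬h (j , r)) ¬unhit
  hit-injective : ∀ {c c′} → proj₁ (hit c) ≡ proj₁ (hit c′) → c ≡ c′
  hit-injective {c} {c′} eq = functional (proj₂ (hit c)) (subst (R c′) (sym eq) (proj₂ (hit c′)))

module PrimeField (q : ℕ) where

  p : ℕ
  p = suc q

  infixl 6 _⊕_ _⊝_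
  infixl 7 _⊛_ _·_
  infix  8 ⊖_
  infix  4 _≈_

  _⊕_ _⊛_ _⊝_ : Fin p → Fin p → Fin p
  _⊕_ = _+ₚ_ p
  _⊛_ = _*ₚ_ p
  a ⊝ b = a ⊕ -ₚ_ p b

  ⊖_ : Fin p → Fin p
  ⊖_ = -ₚ_ p

  _·_ : ℕ → Fin p → Fin p
  _·_ = _·ₚ_ p

  0F 1F : Fin p
  0F = 𝟘 p
  1F = 1 mod p

  -- Field identities are checked on ℕ representatives, with
  -- ⊖ a represented by q * m (q ≡ -1), so that no truncated subtraction occurs. The ring
  -- identities below quantify over q because solve-∀ treats free names as opaque constants.
  record _≈_ (a : Fin p) (m : ℕ) : Set where
    constructor residue
    field toℕ≡ : toℕ a ≡ m % p

  ≈-mod : ∀ m → m mod p ≈ m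
  ≈-mod m = residue (toℕ-fromℕ< _)

  ⟦_⟧ : ∀ a → a ≈ toℕ a
  ⟦ a ⟧ = residue (sym (m<n⇒m%n≡m (toℕ<n a)))

  ≈-≡ : ∀ {a b m n} → a ≈ m → b ≈ n → m % p ≡ n % p → a ≡ b
  ≈-≡ (residue a≡m) (residue b≡n) m≡n = toℕ-injective (trans a≡m (trans m≡n (sym b≡n)))

  ≈-≡-exact : ∀ {a b m n} → a ≈ m → b ≈ n → m ≡ n → a ≡ b
  ≈-≡-exact a≈m b≈n m≡n = ≈-≡ a≈m b≈n (cong (_% p) m≡n)

  ≈-≡-mod : ∀ {a b m n} i j → a ≈ m → b ≈ n → m + i * p ≡ n + j * p → a ≡ b
  ≈-≡-mod {m = m} {n} i j a≈m b≈n eq =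
    ≈-≡ a≈m b≈n (trans (sym ([m+kn]%n≡m%n m i p)) (trans (cong (_% p) eq) ([m+kn]%n≡m%n n j p)))

  ⊕-≈ : ∀ {a b m n} → a ≈ m → b ≈ n → a ⊕ b ≈ m + n
  ⊕-≈ {a} {b} {m} {n} (residue a≡m) (residue b≡n) = residue (begin
    toℕ (a ⊕ b)               ≡⟨ toℕ-fromℕ< _ ⟩
    (toℕ a + toℕ b) % p       ≡⟨ cong₂ (λ x y → (x + y) % p) a≡m b≡n ⟩
    (m % p + n % p) % p       ≡⟨ %-distribˡ-+ m n p ⟨
    (m + n) % p               ∎)
    where open ≡-Reasoning

  *-%-absorbʳ : ∀ i m → (i * (m % p)) % p ≡ (i * m) % p
  *-%-absorbʳ i m = begin
    (i * (m % p)) % p         ≡⟨ %-distribˡ-* i (m % p) p ⟩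
    (i % p * (m % p % p)) % p ≡⟨ cong (λ x → (i % p * x) % p) (m%n%n≡m%n m p) ⟩
    (i % p * (m % p)) % p     ≡⟨ %-distribˡ-* i m p ⟨
    (i * m) % p               ∎
    where open ≡-Reasoning

  ·-≈ : ∀ {a m} i → a ≈ m → i · a ≈ i * m
  ·-≈ {a} {m} i (residue a≡m) =
    residue (trans (toℕ-fromℕ< _) (trans (cong (λ x → (i * x) % p) a≡m) (*-%-absorbʳ i m)))

  ⊛-≈ : ∀ {a b m n} → a ≈ m → b ≈ n → a ⊛ b ≈ m * n
  ⊛-≈ {a} {b} {m} {n} (residue a≡m) (residue b≡n) = residue (begin
    toℕ (a ⊛ b)               ≡⟨ toℕ-fromℕ< _ ⟩
    (toℕ a * toℕ b) % p       ≡⟨ cong₂ (λ x y → (x * y) % p) a≡m b≡n ⟩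
    (m % p * (n % p)) % p     ≡⟨ %-distribˡ-* m n p ⟨
    (m * n) % p               ∎)
    where open ≡-Reasoning

  [p∸r]%p≡[q*r]%p : ∀ r → r < p → (p ∸ r) % p ≡ (q * r) % p
  [p∸r]%p≡[q*r]%p r r<p = begin
    (p ∸ r) % p               ≡⟨ [m+kn]%n≡m%n (p ∸ r) r p ⟨
    ((p ∸ r) + r * p) % p     ≡⟨ cong (_% p) (rearrange (p ∸ r) r q) ⟩
    ((p ∸ r) + r + q * r) % p ≡⟨ cong (λ x → (x + q * r) % p) (m∸n+n≡m (<⇒≤ r<p)) ⟩
    (p + q * r) % p           ≡⟨ cong (_% p) (+-comm p (q * r)) ⟩
    (q * r + p) % p           ≡⟨ [m+n]%n≡m%n (q * r) p ⟩
    (q * r) % p               ∎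
    where
    open ≡-Reasoning
    rearrange : ∀ x r q → x + r * suc q ≡ x + r + q * r
    rearrange = solve-∀

  ⊖-≈ : ∀ {a m} → a ≈ m → ⊖ a ≈ q * m
  ⊖-≈ {a} {m} (residue a≡m) = residue (begin
    toℕ (⊖ a)                 ≡⟨ toℕ-fromℕ< _ ⟩
    (p ∸ toℕ a) % p           ≡⟨ cong (λ x → (p ∸ x) % p) a≡m ⟩
    (p ∸ m % p) % p           ≡⟨ [p∸r]%p≡[q*r]%p (m % p) (m%n<n m p) ⟩
    (q * (m % p)) % p         ≡⟨ *-%-absorbʳ q m ⟩
    (q * m) % p               ∎)
    where open ≡-Reasoning

  ⊝-≈ : ∀ {a b m n} → a ≈ m → b ≈ n → a ⊝ b ≈ m + q * n
  ⊝-≈ a≈m b≈n = ⊕-≈ a≈m (⊖-≈ b≈n)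

  ⊕-identityˡ : ∀ a → 0F ⊕ a ≡ a
  ⊕-identityˡ a = ≈-≡-exact (⊕-≈ (≈-mod 0) ⟦ a ⟧) ⟦ a ⟧ refl

  ⊛-zeroʳ : ∀ a → a ⊛ 0F ≡ 0F
  ⊛-zeroʳ a = ≈-≡-exact (⊛-≈ ⟦ a ⟧ (≈-mod 0)) (≈-mod 0) (*-zeroʳ (toℕ a))

  ⊛-identityˡ : ∀ a → 1F ⊛ a ≡ a
  ⊛-identityˡ a = ≈-≡-exact (⊛-≈ (≈-mod 1) ⟦ a ⟧) ⟦ a ⟧ (*-identityˡ (toℕ a))

  ⊛-identityʳ : ∀ a → a ⊛ 1F ≡ a
  ⊛-identityʳ a = ≈-≡-exact (⊛-≈ ⟦ a ⟧ (≈-mod 1)) ⟦ a ⟧ (*-identityʳ (toℕ a))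

  ⊛-assoc : ∀ a b c → a ⊛ (b ⊛ c) ≡ a ⊛ b ⊛ c
  ⊛-assoc a b c = ≈-≡-exact (⊛-≈ ⟦ a ⟧ (⊛-≈ ⟦ b ⟧ ⟦ c ⟧)) (⊛-≈ (⊛-≈ ⟦ a ⟧ ⟦ b ⟧) ⟦ c ⟧)
                            (sym (*-assoc (toℕ a) (toℕ b) (toℕ c)))

  ⊛-⊖ : ∀ a b → a ⊛ ⊖ b ≡ ⊖ (a ⊛ b)
  ⊛-⊖ a b = ≈-≡-exact (⊛-≈ ⟦ a ⟧ (⊖-≈ ⟦ b ⟧)) (⊖-≈ (⊛-≈ ⟦ a ⟧ ⟦ b ⟧)) (identity q (toℕ a) (toℕ b))
    where
    identity : ∀ q a b → a * (q * b) ≡ q * (a * b)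
    identity = solve-∀

  ⊛-distribʳ-⊝ : ∀ a b c → (a ⊝ b) ⊛ c ≡ a ⊛ c ⊝ b ⊛ c
  ⊛-distribʳ-⊝ a b c =
    ≈-≡-exact (⊛-≈ (⊝-≈ ⟦ a ⟧ ⟦ b ⟧) ⟦ c ⟧) (⊝-≈ (⊛-≈ ⟦ a ⟧ ⟦ c ⟧) (⊛-≈ ⟦ b ⟧ ⟦ c ⟧))
              (identity q (toℕ a) (toℕ b) (toℕ c))
    where
    identity : ∀ q a b c → (a + q * b) * c ≡ a * c + q * (b * c)
    identity = solve-∀

  ⊕-⊝-interchange : ∀ a b c d → (a ⊕ b) ⊝ (c ⊕ d) ≡ (a ⊝ c) ⊕ (b ⊝ d)
  ⊕-⊝-interchange a b c d =
    ≈-≡-exact (⊝-≈ (⊕-≈ ⟦ a ⟧ ⟦ b ⟧) (⊕-≈ ⟦ c ⟧ ⟦ d ⟧)) (⊕-≈ (⊝-≈ ⟦ a ⟧ ⟦ c ⟧) (⊝-≈ ⟦ b ⟧ ⟦ d ⟧))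
              (identity q (toℕ a) (toℕ b) (toℕ c) (toℕ d))
    where
    identity : ∀ q a b c d → a + b + q * (c + d) ≡ a + q * c + (b + q * d)
    identity = solve-∀

  ⊝-self : ∀ a → a ⊝ a ≡ 0F
  ⊝-self a = ≈-≡-mod 0 (toℕ a) (⊝-≈ ⟦ a ⟧ ⟦ a ⟧) (≈-mod 0) (identity q (toℕ a))
    where
    identity : ∀ q a → a + q * a + 0 * suc q ≡ 0 + a * suc q
    identity = solve-∀

  ⊝-⊕-cancelʳ : ∀ a b → a ⊝ b ⊕ b ≡ a
  ⊝-⊕-cancelʳ a b = ≈-≡-mod 0 (toℕ b) (⊕-≈ (⊝-≈ ⟦ a ⟧ ⟦ b ⟧) ⟦ b ⟧) ⟦ a ⟧ (identity q (toℕ a) (toℕ b))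
    where
    identity : ∀ q a b → a + q * b + b + 0 * suc q ≡ a + b * suc q
    identity = solve-∀

  ⊕-⊝-cancelʳ : ∀ a b → a ⊕ b ⊝ b ≡ a
  ⊕-⊝-cancelʳ a b = ≈-≡-mod 0 (toℕ b) (⊝-≈ (⊕-≈ ⟦ a ⟧ ⟦ b ⟧) ⟦ b ⟧) ⟦ a ⟧ (identity q (toℕ a) (toℕ b))
    where
    identity : ∀ q a b → a + b + q * b + 0 * suc q ≡ a + b * suc q
    identity = solve-∀

  ⊕-cancelʳ : ∀ {a b} c → a ⊕ c ≡ b ⊕ c → a ≡ b
  ⊕-cancelʳ {a} {b} c a⊕c≡b⊕c =
    trans (sym (⊕-⊝-cancelʳ a c)) (trans (cong (_⊝ c) a⊕c≡b⊕c) (⊕-⊝-cancelʳ b c))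

  ⊝≡0⇒≡ : ∀ {a b} → a ⊝ b ≡ 0F → a ≡ b
  ⊝≡0⇒≡ {a} {b} a⊝b≡0 =
    trans (sym (⊝-⊕-cancelʳ a b)) (trans (cong (_⊕ b) a⊝b≡0) (⊕-identityˡ b))

  ⊛-inverse : Prime p → ∀ {a} → a ≢ 0F → ∃ λ b → a ⊛ b ≡ 1F
  ⊛-inverse p-prime {a} a≢0
    with coprime-Bézout (prime⇒coprime p-prime {{≢-nonZero toℕa≢0}} (toℕ<n a))
    where
    toℕa≢0 : toℕ a ≢ 0
    toℕa≢0 toℕa≡0 = a≢0 (toℕ-injective toℕa≡0)
  ... | Bézout.-+ x y 1+xp≡ya = y mod p ,
    ≈-≡-mod 0 x (⊛-≈ ⟦ a ⟧ (≈-mod y)) (≈-mod 1) (trans (identity q (toℕ a) y) (sym 1+xp≡ya))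
    where
    identity : ∀ q a y → a * y + 0 * suc q ≡ y * a
    identity = solve-∀
  -- a * y ≡ -1, so ⊖ y inverts a
  ... | Bézout.+- x y 1+ya≡xp = ⊖ (y mod p) ,
    ≈-≡-mod 1 (q * x) (⊛-≈ ⟦ a ⟧ (⊖-≈ (≈-mod y))) (≈-mod 1) (begin
      toℕ a * (q * y) + 1 * p ≡⟨ expand q (toℕ a) y ⟩
      q * (1 + y * toℕ a) + 1 ≡⟨ cong (λ z → q * z + 1) 1+ya≡xp ⟩
      q * (x * p) + 1         ≡⟨ reorder q x ⟩
      1 + q * x * p           ∎)
    where
    open ≡-Reasoning
    expand : ∀ q a y → a * (q * y) + 1 * suc q ≡ q * (1 + y * a) + 1
    expand = solve-∀
    reorder : ∀ q x → q * (x * suc q) + 1 ≡ 1 + q * x * suc q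
    reorder = solve-∀

  ⊛-inverse-cancelˡ : ∀ {m m⁻¹} → m ⊛ m⁻¹ ≡ 1F → ∀ a → m ⊛ (m⁻¹ ⊛ a) ≡ a
  ⊛-inverse-cancelˡ {m} {m⁻¹} m⊛m⁻¹≡1 a =
    trans (⊛-assoc m m⁻¹ a) (trans (cong (_⊛ a) m⊛m⁻¹≡1) (⊛-identityˡ a))

  ⊛-inverse-cancelʳ : ∀ {m m⁻¹} → m ⊛ m⁻¹ ≡ 1F → ∀ a → a ⊛ m ⊛ m⁻¹ ≡ a
  ⊛-inverse-cancelʳ {m} {m⁻¹} m⊛m⁻¹≡1 a =
    trans (sym (⊛-assoc a m m⁻¹)) (trans (cong (a ⊛_) m⊛m⁻¹≡1) (⊛-identityʳ a))

  ⊛-cancelʳ : Prime p → ∀ {a b} x → x ≢ 0F → a ⊛ x ≡ b ⊛ x → a ≡ b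
  ⊛-cancelʳ p-prime {a} {b} x x≢0 a⊛x≡b⊛x with ⊛-inverse p-prime x≢0
  ... | x⁻¹ , x⊛x⁻¹≡1 = begin
    a             ≡⟨ ⊛-inverse-cancelʳ x⊛x⁻¹≡1 a ⟨
    a ⊛ x ⊛ x⁻¹   ≡⟨ cong (_⊛ x⁻¹) a⊛x≡b⊛x ⟩
    b ⊛ x ⊛ x⁻¹   ≡⟨ ⊛-inverse-cancelʳ x⊛x⁻¹≡1 b ⟩
    b             ∎
    where open ≡-Reasoning

  sumₚ-cong : ∀ n {f g : Fin n → Fin p} → (∀ i → f i ≡ g i) → sumₚ p n f ≡ sumₚ p n g
  sumₚ-cong zero    f≗g = refl
  sumₚ-cong (suc n) f≗g = cong₂ _⊕_ (f≗g fz) (sumₚ-cong n (f≗g ∘ fs))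

  sumₚ-⊝ : ∀ n (f g : Fin n → Fin p) → sumₚ p n f ⊝ sumₚ p n g ≡ sumₚ p n (λ i → f i ⊝ g i)
  sumₚ-⊝ zero    f g = ⊝-self 0F
  sumₚ-⊝ (suc n) f g =
    trans (⊕-⊝-interchange (f fz) _ (g fz) _) (cong (f fz ⊝ g fz ⊕_) (sumₚ-⊝ n (f ∘ fs) (g ∘ fs)))

  lincomb-⊝ : ∀ {n} (x c : Fin n → Fin p) (e : Fin n → Vecₚ p n) j →
              lincomb p x e j ⊝ lincomb p c e j ≡ lincomb p (λ i → x i ⊝ c i) e j
  lincomb-⊝ {n} x c e j =
    trans (sumₚ-⊝ n _ _) (sumₚ-cong n λ i → sym (⊛-distribʳ-⊝ (x i) (c i) (e i j)))

  lincomb-cong : ∀ {n} {x c : Fin n → Fin p} (e : Fin n → Vecₚ p n) →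
                 (∀ i → x i ≡ c i) → ∀ j → lincomb p x e j ≡ lincomb p c e j
  lincomb-cong {n} e x≗c j = sumₚ-cong n λ i → cong (_⊛ e i j) (x≗c i)

  basis-coordinates-unique : ∀ {n} {e : Fin n → Vecₚ p n} → IsBasis p e → ∀ {x c} →
    (∀ j → lincomb p x e j ≡ lincomb p c e j) → ∀ i → x i ≡ c i
  basis-coordinates-unique {e = e} (independent , _) {x} {c} x≡c i =
    ⊝≡0⇒≡ (independent (λ i → x i ⊝ c i) difference≡0 i)
    where
    difference≡0 : ∀ j → lincomb p (λ i → x i ⊝ c i) e j ≡ 0F
    difference≡0 j = begin
      lincomb p (λ i → x i ⊝ c i) e j       ≡⟨ lincomb-⊝ x c e j ⟨
      lincomb p x e j ⊝ lincomb p c e j     ≡⟨ cong (_⊝ lincomb p c e j) (x≡c j) ⟩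
      lincomb p c e j ⊝ lincomb p c e j     ≡⟨ ⊝-self (lincomb p c e j) ⟩
      0F                                    ∎
      where open ≡-Reasoning

  CentreOfAP StartOfAP : ℕ → Subset p → Fin p → Set
  CentreOfAP k A a = Σ (Fin p) λ d → d ≢ 0F × (∀ i → i ≤ k → a ⊕ i · d ∈ A × a ⊕ i · ⊖ d ∈ A)
  StartOfAP  k A a = Σ (Fin p) λ d → d ≢ 0F × (∀ i → 1 ≤ i → i ≤ k → a ⊕ i · d ∈ A)

  affine : Fin p → Fin p → Fin p → Fin p
  affine m c x = m ⊛ x ⊕ c

  affine-zero : ∀ m c → affine m c 0F ≡ c
  affine-zero m c = trans (cong (_⊕ c) (⊛-zeroʳ m)) (⊕-identityˡ c)

  affine-AP : ∀ m c a i d → affine m c (a ⊕ i · d) ≡ affine m c a ⊕ i · (m ⊛ d)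
  affine-AP m c a i d =
    ≈-≡-exact (⊕-≈ (⊛-≈ ⟦ m ⟧ (⊕-≈ ⟦ a ⟧ (·-≈ i ⟦ d ⟧))) ⟦ c ⟧)
              (⊕-≈ (⊕-≈ (⊛-≈ ⟦ m ⟧ ⟦ a ⟧) ⟦ c ⟧) (·-≈ i (⊛-≈ ⟦ m ⟧ ⟦ d ⟧)))
              (identity (toℕ m) (toℕ a) (toℕ c) i (toℕ d))
    where
    identity : ∀ m a c i d → m * (a + i * d) + c ≡ m * a + c + i * (m * d)
    identity = solve-∀

  module _ (m : Fin p) (invertible : ∃ λ m⁻¹ → m ⊛ m⁻¹ ≡ 1F) (c : Fin p) where

    private
      m⁻¹ : Fin p
      m⁻¹ = proj₁ invertible
      cancel : ∀ a → m ⊛ (m⁻¹ ⊛ a) ≡ a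
      cancel = ⊛-inverse-cancelˡ {m} {m⁻¹} (proj₂ invertible)

    affine-AP⁺ : ∀ a i d → affine m c (a ⊕ i · (m⁻¹ ⊛ d)) ≡ affine m c a ⊕ i · d
    affine-AP⁺ a i d = trans (affine-AP m c a i (m⁻¹ ⊛ d))
                             (cong (λ z → affine m c a ⊕ i · z) (cancel d))

    affine-AP⁻ : ∀ a i d → affine m c (a ⊕ i · (⊖ (m⁻¹ ⊛ d))) ≡ affine m c a ⊕ i · (⊖ d)
    affine-AP⁻ a i d = trans (affine-AP m c a i (⊖ (m⁻¹ ⊛ d)))
      (cong (λ z → affine m c a ⊕ i · z) (trans (⊛-⊖ m _) (cong ⊖_ (cancel d))))

    affine-section : ∀ z → affine m c (m⁻¹ ⊛ (z ⊝ c)) ≡ z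
    affine-section z = trans (cong (_⊕ c) (cancel (z ⊝ c))) (⊝-⊕-cancelʳ z c)

    inverse-⊛-≢0 : ∀ {d} → d ≢ 0F → m⁻¹ ⊛ d ≢ 0F
    inverse-⊛-≢0 {d} d≢0 m⁻¹⊛d≡0 =
      d≢0 (trans (sym (cancel d)) (trans (cong (m ⊛_) m⁻¹⊛d≡0) (⊛-zeroʳ m)))

    preimage-affine-SType : ∀ {k A} → SType p k A → SType p k (preimage (affine m c) A)
    preimage-affine-SType {k} {A} ((z , z∈A) , centred) =
      (m⁻¹ ⊛ (z ⊝ c) , ∈-preimage {g = affine m c} (subst (_∈ A) (sym (affine-section z)) z∈A)) , centred′
      where
      centred′ : ∀ a → a ∈ preimage (affine m c) A → CentreOfAP k (preimage (affine m c) A) a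
      centred′ a a∈ with centred (affine m c a) (∈-preimage⁻ {g = affine m c} a∈)
      ... | d , d≢0 , AP = m⁻¹ ⊛ d , inverse-⊛-≢0 d≢0 , λ i i≤k →
        ∈-preimage {g = affine m c} (subst (_∈ A) (sym (affine-AP⁺ a i d)) (proj₁ (AP i i≤k))) ,
        ∈-preimage {g = affine m c} (subst (_∈ A) (sym (affine-AP⁻ a i d)) (proj₂ (AP i i≤k)))

    preimage-affine-NType : ∀ {k A} → NType p k A → NType p k (preimage (affine m c) A)
    preimage-affine-NType {k} {A} (S-type , started) = preimage-affine-SType S-type , started′
      where
      started′ : ∀ a → a ∉ preimage (affine m c) A → StartOfAP k (preimage (affine m c) A) a
      started′ a a∉ with started (affine m c a) (a∉ ∘ ∈-preimage {g = affine m c})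
      ... | d , d≢0 , AP = m⁻¹ ⊛ d , inverse-⊛-≢0 d≢0 , λ i 1≤i i≤k →
        ∈-preimage {g = affine m c} (subst (_∈ A) (sym (affine-AP⁺ a i d)) (AP i 1≤i i≤k))

  separating-scalars : Prime p → ∀ {n s t} → 1 ≤ n → t * s < q →
    (σ : Fin s → Fin p) (τ : Fin t → Fin p) (c : Fin p) → (∀ u → σ u ≢ c) →
    (e f : Fin n → Vecₚ p n) → IsBasis p e →
    Σ (Fin n → Fin q) λ μ → ∀ x y →
      (∀ i → ∃ λ u → σ u ≡ affine (fs (μ i)) c (x i)) → (∀ i → ∃ λ v → τ v ≡ y i) →
      ¬ (∀ j → lincomb p x e j ≡ lincomb p y f j)
  separating-scalars p-prime {n} {s} {t} 1≤n ts<q σ τ c σ≢c e f e-basis@(_ , spans) =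
    finToFun μ-code , separated
    where
    -- A code fixes, for every coordinate i, the position of yᵢ in τ and that of μᵢ xᵢ + c in σ.
    Code : Set
    Code = Fin n → Fin (t * s)

    y⟨_⟩ x⟨_⟩ : Code → Fin n → Fin p
    y⟨ w ⟩ i = τ (proj₁ (remQuot {t} s (w i)))
    x⟨ w ⟩   = proj₁ (spans (lincomb p y⟨ w ⟩ f))

    Hit : (Fin n → Fin q) → Code → Set
    Hit μ w = ∀ i → σ (proj₂ (remQuot {t} s (w i))) ≡ affine (fs (μ i)) c (x⟨ w ⟩ i)

    hit-functional : ∀ {μ μ′ w} → Hit μ w → Hit μ′ w → ∀ i → μ i ≡ μ′ i
    hit-functional {μ} {μ′} {w} hit hit′ i =
      suc-injective (⊛-cancelʳ p-prime (x⟨ w ⟩ i) x≢0 (⊕-cancelʳ c (trans (sym (hit i)) (hit′ i))))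
      where
      x≢0 : x⟨ w ⟩ i ≢ 0F
      x≢0 x≡0 = σ≢c _
        (trans (hit i) (trans (cong (affine (fs (μ i)) c) x≡0) (affine-zero (fs (μ i)) c)))

    unhit : ∃ λ μ-code → ∀ w-code → ¬ Hit (finToFun μ-code) (finToFun w-code)
    unhit = ∃-unrelated (λ μ w → Hit (finToFun μ) (finToFun w)) (λ μ w → all? λ i → _ ≟ _)
                    (λ hit hit′ → finToFun-injective (hit-functional hit hit′))
                    (^-monoˡ-< n {{>-nonZero 1≤n}} ts<q)

    μ-code = proj₁ unhit

    separated : ∀ x y → (∀ i → ∃ λ u → σ u ≡ affine (fs (finToFun μ-code i)) c (x i)) →
                (∀ i → ∃ λ v → τ v ≡ y i) → ¬ (∀ j → lincomb p x e j ≡ lincomb p y f j)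
    separated x y x-hit y-hit x≡y = proj₂ unhit (funToFin w) hit
      where
      w : Code
      w i = combine (proj₁ (y-hit i)) (proj₁ (x-hit i))
      w′ : Code
      w′ = finToFun (funToFin w)
      decode : ∀ i → remQuot {t} s (w′ i) ≡ (proj₁ (y-hit i) , proj₁ (x-hit i))
      decode i = trans (cong (remQuot s) (finToFun-funToFin w i)) (remQuot-combine _ _)
      y-decoded : ∀ i → y⟨ w′ ⟩ i ≡ y i
      y-decoded i = trans (cong (τ ∘ proj₁) (decode i)) (proj₂ (y-hit i))
      x-decoded : ∀ i → x⟨ w′ ⟩ i ≡ x i
      x-decoded = basis-coordinates-unique e-basis λ j → begin
        lincomb p x⟨ w′ ⟩ e j ≡⟨ proj₂ (spans (lincomb p y⟨ w′ ⟩ f)) j ⟩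
        lincomb p y⟨ w′ ⟩ f j ≡⟨ lincomb-cong f y-decoded j ⟩
        lincomb p y f j       ≡⟨ x≡y j ⟨
        lincomb p x e j       ∎
        where open ≡-Reasoning
      hit : Hit (finToFun μ-code) w′
      hit i = trans (cong (σ ∘ proj₂) (decode i))
                    (trans (proj₂ (x-hit i)) (cong (affine (fs (finToFun μ-code i)) c) (sym (x-decoded i))))

  SeparatingFamilies : ∀ {n} → ℕ → (e f : Fin n → Vecₚ p n) → Set
  SeparatingFamilies {n} k e f =
    Σ (Fin n → Subset p) λ A → Σ (Fin n → Subset p) λ B →
      (∀ i → 0F ∉ A i) × (∀ i → 0F ∉ B i) ×
      (∀ i → SType p k (A i)) × (∀ i → NType p k (B i)) ×
      (∀ (x y : Fin n → Fin p) → (∀ i → x i ∈ A i) → (∀ i → y i ∈ B i) →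
        ¬ (∀ j → lincomb p x e j ≡ lincomb p y f j))

  separating-families : Prime p → ∀ {n k} → 1 ≤ n → (S₀ N₀ : Subset p) →
    SType p k S₀ → NType p k N₀ → ∣ N₀ ∣ * ∣ S₀ ∣ < q →
    (e f : Fin n → Vecₚ p n) → IsBasis p e → SeparatingFamilies k e f
  separating-families p-prime {n} {k} 1≤n S₀ N₀ S₀-type N₀-type ts<q e f e-basis =
    A , B , 0∉A , 0∉B , A-type , B-type , separated
    where
    s≤ts : ∣ S₀ ∣ ≤ ∣ N₀ ∣ * ∣ S₀ ∣
    s≤ts = m≤n*m _ _ {{>-nonZero (x∈p⇒0<∣p∣ (proj₂ (proj₁ (proj₁ N₀-type))))}}
    t≤ts : ∣ N₀ ∣ ≤ ∣ N₀ ∣ * ∣ S₀ ∣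
    t≤ts = m≤m*n _ _ {{>-nonZero (x∈p⇒0<∣p∣ (proj₂ (proj₁ S₀-type)))}}

    outside-S₀ : ∃ λ c₀ → c₀ ∉ S₀
    outside-S₀ = ∣p∣<n⇒∃∉ S₀ (m<n⇒m<1+n (≤-<-trans s≤ts ts<q))
    outside-N₀ : ∃ λ c₁ → c₁ ∉ N₀
    outside-N₀ = ∣p∣<n⇒∃∉ N₀ (m<n⇒m<1+n (≤-<-trans t≤ts ts<q))

    c₀ c₁ : Fin p
    c₀ = proj₁ outside-S₀
    c₁ = proj₁ outside-N₀

    σ : Fin ∣ S₀ ∣ → Fin p
    σ = proj₁ (enumerate S₀)
    ν : Fin ∣ N₀ ∣ → Fin p
    ν = proj₁ (enumerate N₀)

    σ≢c₀ : ∀ u → σ u ≢ c₀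
    σ≢c₀ u σu≡c₀ = proj₂ outside-S₀ (subst (_∈ S₀) σu≡c₀ (proj₁ (proj₂ (enumerate S₀)) u))

    scalars : Σ (Fin n → Fin q) λ μ → ∀ x y →
      (∀ i → ∃ λ u → σ u ≡ affine (fs (μ i)) c₀ (x i)) → (∀ i → ∃ λ v → ν v ⊝ c₁ ≡ y i) →
      ¬ (∀ j → lincomb p x e j ≡ lincomb p y f j)
    scalars = separating-scalars p-prime 1≤n ts<q σ (λ v → ν v ⊝ c₁) c₀ σ≢c₀ e f e-basis

    μ : Fin n → Fin q
    μ = proj₁ scalars

    A B : Fin n → Subset p
    A i = preimage (affine (fs (μ i)) c₀) S₀
    B _ = preimage (affine 1F c₁) N₀

    0∉A : ∀ i → 0F ∉ A i
    0∉A i 0∈A = proj₂ outside-S₀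
      (subst (_∈ S₀) (affine-zero (fs (μ i)) c₀) (∈-preimage⁻ {g = affine (fs (μ i)) c₀} {S₀} 0∈A))
    0∉B : ∀ i → 0F ∉ B i
    0∉B i 0∈B = proj₂ outside-N₀
      (subst (_∈ N₀) (affine-zero 1F c₁) (∈-preimage⁻ {g = affine 1F c₁} {N₀} 0∈B))

    A-type : ∀ i → SType p k (A i)
    A-type i = preimage-affine-SType (fs (μ i)) (⊛-inverse p-prime {fs (μ i)} λ ()) c₀ S₀-type
    B-type : ∀ i → NType p k (B i)
    B-type i = preimage-affine-NType 1F (1F , ⊛-identityˡ 1F) c₁ N₀-type

    separated : ∀ (x y : Fin n → Fin p) → (∀ i → x i ∈ A i) → (∀ i → y i ∈ B i) →
                ¬ (∀ j → lincomb p x e j ≡ lincomb p y f j)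
    separated x y x∈A y∈B = proj₂ scalars x y x-hit y-hit
      where
      x-hit : ∀ i → ∃ λ u → σ u ≡ affine (fs (μ i)) c₀ (x i)
      x-hit i = proj₂ (proj₂ (enumerate S₀)) (∈-preimage⁻ {g = affine (fs (μ i)) c₀} {S₀} (x∈A i))
      y-hit : ∀ i → ∃ λ v → ν v ⊝ c₁ ≡ y i
      y-hit i = v , (begin
        ν v ⊝ c₁                ≡⟨ cong (_⊝ c₁) νv≡ ⟩
        affine 1F c₁ (y i) ⊝ c₁ ≡⟨ ⊕-⊝-cancelʳ (1F ⊛ y i) c₁ ⟩
        1F ⊛ y i                ≡⟨ ⊛-identityˡ (y i) ⟩
        y i                     ∎)
        where
        open ≡-Reasoning
        v-covers : ∃ λ v → ν v ≡ affine 1F c₁ (y i)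
        v-covers = proj₂ (proj₂ (enumerate N₀)) (∈-preimage⁻ {g = affine 1F c₁} {N₀} (y∈B i))
        v : Fin ∣ N₀ ∣
        v = proj₁ v-covers
        νv≡ : ν v ≡ affine 1F c₁ (y i)
        νv≡ = proj₂ v-covers

-- Only sets attaining N_k(p) and S_k(p) are used, not their minimality; neither are
-- 1 ≤ k, 2k + 1 ≤ p or the basis property of f.
corollary2 : (n k p : ℕ) .{{_ : NonZero p}} → 1 ≤ n → 1 ≤ k → Prime p → 2 * k + 1 ≤ p →
    (Nk Sk : ℕ) → IsMinSize p (NType p k) Nk → IsMinSize p (SType p k) Sk → Nk * Sk < p ∸ 1 →
    (e f : Fin n → Vecₚ p n) → IsBasis p e → IsBasis p f →
    Σ (Fin n → Subset p) λ A → Σ (Fin n → Subset p) λ B →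
      (∀ i → 𝟘 p ∉ A i) × (∀ i → 𝟘 p ∉ B i) ×
      (∀ i → SType p k (A i)) × (∀ i → NType p k (B i)) ×
      (∀ (x y : Fin n → Fin p) → (∀ i → x i ∈ A i) → (∀ i → y i ∈ B i) →
        ¬ (∀ j → lincomb p x e j ≡ lincomb p y f j))
corollary2 n k zero _ _ _ _ _ _ _ _ _ _ _ _ _ = contradiction refl (≢-nonZero⁻¹ 0)
corollary2 n k (suc q) 1≤n _ p-prime _ Nk Sk
           ((N₀ , N₀-type , ∣N₀∣≡Nk) , _) ((S₀ , S₀-type , ∣S₀∣≡Sk) , _) NkSk<q e f e-basis _ =
  separating-families p-prime 1≤n S₀ N₀ S₀-type N₀-type ∣N₀∣∣S₀∣<q e f e-basis
  where
  open PrimeField q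
  ∣N₀∣∣S₀∣<q : ∣ N₀ ∣ * ∣ S₀ ∣ < q
  ∣N₀∣∣S₀∣<q = subst₂ (λ t s → t * s < q) (sym ∣N₀∣≡Nk) (sym ∣S₀∣≡Sk) NkSk<q
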